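{- Let $h^{(1)},\dots,h^{(\ell)}\in\mathbb{Z}[x]$ be intersective polynomials, $d_1,\dots,d_\ell\in\mathbb{N}$, and $A\subseteq\mathbb{N}$. Suppose $x\in\mathbb{Z}$, $q\in\mathbb{N}$, $$(A-A)\cap\left(I(h^{(1)}_{d_1})+\cdots+I(h^{(\ell)}_{d_\ell})\right)\subseteq\{0\},$$ and $A'\subseteq\{a\in\mathbb{N}:x+\Lambda(q)a\in A\}$. Then $$(A'-A')\cap\left(I(h^{(1)}_{\tilde\lambda_1(q)d_1})+\cdots+I(h^{(\ell)}_{\tilde\lambda_\ell(q)d_\ell})\right)\subseteq\{0\}.$$
   Context: $\mathbb{N}=\{1,2,\dots\}$. A polynomial $h\in\mathbb{Z}[x]$ is intersective if it is nonzero and $h(\mathbb{N})$ contains a multiple of every $q\in\mathbb{N}$ (equivalently, $h$ has a $p$-adic integer root for every prime $p$). For each $i$, fix for every prime $p$ a $p$-adic integer root $z^{(i)}_p$ of $h^{(i)}$ with multiplicity $m^{(i)}_p$; for $d\in\mathbb{N}$ let $r^{(i)}_d$ be the unique integer in $(-d,0]$ with $r^{(i)}_d\equiv z^{(i)}_p\pmod{p^j}$ whenever $p^j$ exactly divides $d$; let $\lambda_i$ be the completely multiplicative function on $\mathbb{N}$ with $\lambda_i(p)=p^{m^{(i)}_p}$; and define $h^{(i)}_d(x)=h^{(i)}(r^{(i)}_d+dx)/\lambda_i(d)\in\mathbb{Z}[x]$. Let $\Lambda=\lambda_1\circ\cdots\circ\lambda_\ell$ (composition) and $\tilde\lambda_i=\lambda_1\circ\cdots\circ\lambda_{i-1}\circ\lambda_{i+1}\circ\cdots\circ\lambda_\ell$.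 For nonzero $f\in\mathbb{Z}[x]$, $I(f)$ is the set of positive elements of $f(\mathbb{N})$ if $f$ has positive leading coefficient, and the set of negative elements of $f(\mathbb{N})$ otherwise. $X\pm Y=\{x\pm y:x\in X,y\in Y\}$. -}

module Defs where

open import Data.Nat as ℕ using (ℕ; zero; suc; _^_; NonZero)
open import Data.Nat.Primality using (Prime)
open import Data.Nat.Combinatorics using (_C_)
import Data.Nat.Divisibility as ℕD
open import Data.Integer as ℤ using (ℤ; +_; _+_; _*_; _-_; _<_; _≤_; -_; 0ℤ)
open import Data.Integer.Divisibility using (_∣_)
open import Data.Integer.DivMod using (_/ℕ_)
open import Data.Fin using (Fin; zero; suc)
open import Data.List using (List; []; _∷_; length; drop; zipWith; upTo; map)
open import Data.Product using (Σ; ∃; _×_; _,_)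
open import Data.Sum using (_⊎_)
open import Relation.Nullary using (¬_; does)
open import Relation.Binary.PropositionalEquality using (_≡_)
open import Data.Bool using (if_then_else_)
open import Function using (id; _∘_)

-- Polynomials in ℤ[x]: coefficient lists, lowest degree first.

Poly : Set
Poly = List ℤ

eval : Poly → ℤ → ℤ
eval []       x = 0ℤ
eval (a ∷ as) x = a + x * eval as x

data NonZeroPoly : Poly → Set where
  here  : ∀ {a as} → ¬ (a ≡ 0ℤ) → NonZeroPoly (a ∷ as)
  there : ∀ {a as} → NonZeroPoly as → NonZeroPoly (a ∷ as)

-- leading coefficient (last nonzero coefficient; 0 for the zero polynomial)
lead : Poly → ℤ
lead []       = 0ℤ
lead (a ∷ as) = if does (lead as ℤ.≟ 0ℤ) then a else lead as

_+ₚ_ : Poly → Poly → Poly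
[]       +ₚ q        = q
(a ∷ as) +ₚ []       = a ∷ as
(a ∷ as) +ₚ (b ∷ bs) = (a + b) ∷ (as +ₚ bs)

scale : ℤ → Poly → Poly
scale c = map (c *_)

mulLin : ℤ → ℤ → Poly → Poly
mulLin r d q = scale r q +ₚ (0ℤ ∷ scale d q)

-- the polynomial h(r + d x)
compLin : Poly → ℤ → ℤ → Poly
compLin []       r d = []
compLin (a ∷ as) r d = (a ∷ []) +ₚ mulLin r d (compLin as r d)

-- integer division of a coefficient by a natural number (exact in our use)
divBy : ℤ → ℕ → ℤ
divBy a zero    = 0ℤ
divBy a (suc k) = a /ℕ suc k

-- k-th Hasse derivative (Taylor coefficient): Σ C(n,k) a_n x^(n-k)
hasse : ℕ → Poly → Poly
hasse k as = drop k (zipWith (λ n a → + (n C k) * a) (upTo (length as)) as)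

-- Intersective polynomials (ℕ = {1,2,...}).

Intersective : Poly → Set
Intersective h = NonZeroPoly h ×
  (∀ q → 1 ℕ.≤ q → ∃ λ n → 1 ℕ.≤ n × (+ q ∣ eval h (+ n)))

-- p-adic integers as compatible residue sequences z j ∈ [0, p^j).

record ℤₚ (p : ℕ) : Set where
  field
    digit   : ℕ → ℕ
    bounded : ∀ j → digit j ℕ.< p ^ j
    compat  : ∀ j → + (p ^ j) ∣ (+ digit (suc j) - + digit j)
open ℤₚ public

-- a p-adic integer z "is zero" for the value of g at z
VanishesAt : (p : ℕ) → Poly → ℤₚ p → Set
VanishesAt p g z = ∀ j → + (p ^ j) ∣ eval g (+ digit z j)

IsRoot : (p : ℕ) → Poly → ℤₚ p → Set
IsRoot p h z = VanishesAt p h z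

-- z is a root of multiplicity m: the Taylor coefficients of h at z
-- vanish in ℤₚ below order m and the m-th does not (h = (x-z)^m g, g(z) ≠ 0)
HasMultiplicity : (p : ℕ) → Poly → ℤₚ p → ℕ → Set
HasMultiplicity p h z m =
  (∀ k → k ℕ.< m → VanishesAt p (hasse k h) z) × ¬ VanishesAt p (hasse m h) z

-- Data attached to an intersective polynomial: chosen p-adic roots with
-- multiplicities, the function r_d, and the completely multiplicative λ.

record RootData (h : Poly) : Set where
  field
    root     : (p : ℕ) → Prime p → ℤₚ p
    isRoot   : (p : ℕ) (pp : Prime p) → IsRoot p h (root p pp)
    mult     : (p : ℕ) → Prime p → ℕ
    isMult   : (p : ℕ) (pp : Prime p) → HasMultiplicity p h (root p pp) (mult p pp)
    r        : ℕ → ℤ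
    r-range  : ∀ d → 1 ℕ.≤ d → (- + d < r d) × (r d ≤ 0ℤ)
    r-cong   : ∀ d → 1 ℕ.≤ d → (p j : ℕ) (pp : Prime p) →
               p ^ j ℕD.∣ d → ¬ (p ^ suc j ℕD.∣ d) →
               + (p ^ j) ∣ (r d - + digit (root p pp) j)
    lam      : ℕ → ℕ
    lam-one  : lam 1 ≡ 1
    lam-mul  : ∀ a b → 1 ℕ.≤ a → 1 ℕ.≤ b → lam (a ℕ.* b) ≡ lam a ℕ.* lam b
    lam-prime : (p : ℕ) (pp : Prime p) → lam p ≡ p ^ mult p pp
open RootData public

hd : (h : Poly) → RootData h → ℕ → Poly
hd h D d = map (λ c → divBy c (lam D d)) (compLin h (r D d) (+ d))

-- I(f): positive (resp. negative) elements of f(ℕ), ℕ = {1,2,...}.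

I : Poly → ℤ → Set
I f y = (∃ λ n → 1 ℕ.≤ n × eval f (+ n) ≡ y) ×
        ((0ℤ < lead f × 0ℤ < y) ⊎ (lead f ≤ 0ℤ × y < 0ℤ))

sumFin : (n : ℕ) → (Fin n → ℤ) → ℤ
sumFin zero    f = 0ℤ
sumFin (suc n) f = f zero + sumFin n (f ∘ suc)

SumSet : (ℓ : ℕ) → (Fin ℓ → ℤ → Set) → ℤ → Set
SumSet ℓ S y = Σ (Fin ℓ → ℤ) λ ys → (∀ i → S i (ys i)) × (y ≡ sumFin ℓ ys)

compAll : (n : ℕ) → (Fin n → ℕ → ℕ) → ℕ → ℕ
compAll zero    f = id
compAll (suc n) f = f zero ∘ compAll n (f ∘ suc)

compOmit : (n : ℕ) → (Fin n → ℕ → ℕ) → Fin n → ℕ → ℕ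
compOmit (suc n) f zero    = compAll n (f ∘ suc)
compOmit (suc n) f (suc i) = f zero ∘ compOmit n (f ∘ suc) i

DiffFree : (ℕ → Set) → (ℤ → Set) → Set
DiffFree A S = ∀ a b → A a → A b → S (+ a - + b) → + a - + b ≡ 0ℤ

module Submission where

-- Write Λ = λ₁ ∘ ⋯ ∘ λ_ℓ.  The heart of the proof is the transfer lemma
-- (Transfer.I-transfer): for Q ≥ 1, y ∈ I(h_{Qd}) implies λ(Q) y ∈ I(h_d).
-- Since r_{Qd} ≡ r_d (mod d) and both lie in the right windows, there is
-- c ≥ 1 with r_{Qd} + Qd(n+1) = r_d + d(c + Qn), so h_d(c + Qn) = λ(Q) h_{Qd}(n+1);
-- eventual signs, hence the signs of the leading coefficients, then agree.
-- The identity uses that λ(d) divides every coefficient of h(r_d + d x),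
-- which is checked prime by prime: if p^e ∥ d then r_d ≡ z_p (mod p^e), and a
-- Taylor expansion at the p-adic root z_p of multiplicity m_p produces the
-- factor p^(e m_p) of λ(d).
-- Proposition 5 follows by scaling a difference a - b in A′ by Λ(q), using
-- λᵢ ∘ λ̃ᵢ = Λ (the λ's commute).

open import Defs

module Polynomials where

  open import Data.Nat as ℕ using (ℕ; zero; suc)
  import Data.Nat.Properties as ℕP
  open import Data.Nat.Combinatorics using (_C_; nCk+nC[k+1]≡[n+1]C[k+1]; nCn≡1)
  open import Data.Integer using (ℤ; +_; _+_; _*_; 0ℤ)
  import Data.Integer.Properties as ℤP
  open import Data.Integer.Tactic.RingSolver using (solve-∀)
  open import Data.List using ([]; _∷_; length; drop; zipWith; applyUpTo)
  open import Relation.Binary.PropositionalEquality using (_≡_; refl; sym; trans; cong; cong₂; module ≡-Reasoning)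
  open import Function using (_∘_)

  coef : Poly → ℕ → ℤ
  coef []       n       = 0ℤ
  coef (a ∷ as) zero    = a
  coef (a ∷ as) (suc n) = coef as n

  eval-coef≡0 : ∀ P t → (∀ i → coef P i ≡ 0ℤ) → eval P t ≡ 0ℤ
  eval-coef≡0 []      t P≡0 = refl
  eval-coef≡0 (a ∷ P) t P≡0
    rewrite P≡0 0 | eval-coef≡0 P t (P≡0 ∘ suc) = trans (ℤP.+-identityˡ _) (ℤP.*-zeroʳ t)

  eval-cong : ∀ P Q t → (∀ i → coef P i ≡ coef Q i) → eval P t ≡ eval Q t
  eval-cong []      Q       t P≡Q = sym (eval-coef≡0 Q t (sym ∘ P≡Q))
  eval-cong (a ∷ P) []      t P≡Q = eval-coef≡0 (a ∷ P) t P≡Q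
  eval-cong (a ∷ P) (b ∷ Q) t P≡Q
    rewrite P≡Q 0 | eval-cong P Q t (P≡Q ∘ suc) = refl

  coef-+ₚ : ∀ P Q i → coef (P +ₚ Q) i ≡ coef P i + coef Q i
  coef-+ₚ []      Q       i       = sym (ℤP.+-identityˡ _)
  coef-+ₚ (a ∷ P) []      i       = sym (ℤP.+-identityʳ _)
  coef-+ₚ (a ∷ P) (b ∷ Q) zero    = refl
  coef-+ₚ (a ∷ P) (b ∷ Q) (suc i) = coef-+ₚ P Q i

  eval-+ₚ : ∀ P Q t → eval (P +ₚ Q) t ≡ eval P t + eval Q t
  eval-+ₚ []      Q       t = sym (ℤP.+-identityˡ _)
  eval-+ₚ (a ∷ P) []      t = sym (ℤP.+-identityʳ _)
  eval-+ₚ (a ∷ P) (b ∷ Q) t rewrite eval-+ₚ P Q t = identity a b t (eval P t) (eval Q t)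
    where
      identity : ∀ a b t x y → a + b + t * (x + y) ≡ a + t * x + (b + t * y)
      identity = solve-∀

  coef-scale : ∀ c P i → coef (scale c P) i ≡ c * coef P i
  coef-scale c []      i       = sym (ℤP.*-zeroʳ c)
  coef-scale c (a ∷ P) zero    = refl
  coef-scale c (a ∷ P) (suc i) = coef-scale c P i

  eval-scale : ∀ c P t → eval (scale c P) t ≡ c * eval P t
  eval-scale c []      t = sym (ℤP.*-zeroʳ c)
  eval-scale c (a ∷ P) t rewrite eval-scale c P t = identity c a t (eval P t)
    where
      identity : ∀ c a t x → c * a + t * (c * x) ≡ c * (a + t * x)
      identity = solve-∀

  eval-compLin : ∀ h r d x → eval (compLin h r d) x ≡ eval h (r + d * x)
  eval-compLin []      r d x = refl
  eval-compLin (a ∷ h) r d x =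
    begin
      eval ((a ∷ []) +ₚ (scale r G +ₚ (0ℤ ∷ scale d G))) x
    ≡⟨ eval-+ₚ (a ∷ []) (scale r G +ₚ (0ℤ ∷ scale d G)) x ⟩
      eval (a ∷ []) x + eval (scale r G +ₚ (0ℤ ∷ scale d G)) x
    ≡⟨ cong (λ u → eval (a ∷ []) x + u) (eval-+ₚ (scale r G) _ x) ⟩
      (a + x * 0ℤ) + (eval (scale r G) x + (0ℤ + x * eval (scale d G) x))
    ≡⟨ cong₂ (λ u v → (a + x * 0ℤ) + (u + (0ℤ + x * v))) (eval-scale r G x) (eval-scale d G x) ⟩
      (a + x * 0ℤ) + (r * eval G x + (0ℤ + x * (d * eval G x)))
    ≡⟨ cong (λ u → (a + x * 0ℤ) + (r * u + (0ℤ + x * (d * u)))) (eval-compLin h r d x) ⟩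
      (a + x * 0ℤ) + (r * E + (0ℤ + x * (d * E)))
    ≡⟨ identity a x r d E ⟩
      a + (r + d * x) * E
    ∎
    where
      open ≡-Reasoning
      G = compLin h r d
      E = eval h (r + d * x)
      identity : ∀ a x r d E → (a + x * 0ℤ) + (r * E + (0ℤ + x * (d * E))) ≡ a + (r + d * x) * E
      identity = solve-∀

  coef-drop : ∀ k L i → coef (drop k L) i ≡ coef L (k ℕ.+ i)
  coef-drop zero    L       i = refl
  coef-drop (suc k) []      i = refl
  coef-drop (suc k) (a ∷ L) i = coef-drop k L i

  coef-binomials : ∀ k (f : ℕ → ℕ) as i →
    coef (zipWith (λ n a → + (n C k) * a) (applyUpTo f (length as)) as) i ≡ + (f i C k) * coef as i
  coef-binomials k f []       i       = sym (ℤP.*-zeroʳ (+ (f i C k)))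
  coef-binomials k f (a ∷ as) zero    = refl
  coef-binomials k f (a ∷ as) (suc i) = coef-binomials k (f ∘ suc) as i

  coef-hasse : ∀ k h i → coef (hasse k h) i ≡ + ((k ℕ.+ i) C k) * coef h (k ℕ.+ i)
  coef-hasse k h i = trans (coef-drop k _ i) (coef-binomials k (λ n → n) h (k ℕ.+ i))

  -- the k-th Taylor coefficient of h at t, i.e. the coefficient of x^k in h(t + x)
  taylor : ℕ → Poly → ℤ → ℤ
  taylor k h t = eval (hasse k h) t

  taylor-0 : ∀ h t → taylor 0 h t ≡ eval h t
  taylor-0 h t = eval-cong (hasse 0 h) h t (λ i → trans (coef-hasse 0 h i) (ℤP.*-identityˡ _))

  taylor-[] : ∀ k t → taylor k [] t ≡ 0ℤ
  taylor-[] zero    t = refl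
  taylor-[] (suc k) t = refl

  taylor-+ₚ : ∀ k P Q t → taylor k (P +ₚ Q) t ≡ taylor k P t + taylor k Q t
  taylor-+ₚ k P Q t = trans (eval-cong (hasse k (P +ₚ Q)) (hasse k P +ₚ hasse k Q) t same)
                            (eval-+ₚ (hasse k P) (hasse k Q) t)
    where
      same : ∀ i → coef (hasse k (P +ₚ Q)) i ≡ coef (hasse k P +ₚ hasse k Q) i
      same i rewrite coef-hasse k (P +ₚ Q) i | coef-+ₚ (hasse k P) (hasse k Q) i
                   | coef-hasse k P i | coef-hasse k Q i | coef-+ₚ P Q (k ℕ.+ i)
                   = ℤP.*-distribˡ-+ (+ ((k ℕ.+ i) C k)) (coef P (k ℕ.+ i)) (coef Q (k ℕ.+ i))

  taylor-scale : ∀ k c P t → taylor k (scale c P) t ≡ c * taylor k P t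
  taylor-scale k c P t = trans (eval-cong (hasse k (scale c P)) (scale c (hasse k P)) t same)
                               (eval-scale c (hasse k P) t)
    where
      swap : ∀ a c b → a * (c * b) ≡ c * (a * b)
      swap = solve-∀
      same : ∀ i → coef (hasse k (scale c P)) i ≡ coef (scale c (hasse k P)) i
      same i rewrite coef-hasse k (scale c P) i | coef-scale c (hasse k P) i
                   | coef-hasse k P i | coef-scale c P (k ℕ.+ i)
                   = swap (+ ((k ℕ.+ i) C k)) c (coef P (k ℕ.+ i))

  -- Pascal's rule: for h = a + x·g the Taylor coefficients satisfy
  -- h^{(k+1)}(t) = t g^{(k+1)}(t) + g^{(k)}(t)
  taylor-cons : ∀ k a as t → taylor (suc k) (a ∷ as) t ≡ t * taylor (suc k) as t + taylor k as t
  taylor-cons k a as t =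
    trans (eval-cong (hasse (suc k) (a ∷ as)) ((0ℤ ∷ hasse (suc k) as) +ₚ hasse k as) t same)
      (trans (eval-+ₚ (0ℤ ∷ hasse (suc k) as) (hasse k as) t)
             (cong (_+ taylor k as t) (ℤP.+-identityˡ (t * taylor (suc k) as t))))
    where
      pascal : ∀ e k c → + (suc e C suc k) * c ≡ + (e C suc k) * c + + (e C k) * c
      pascal e k c rewrite sym (nCk+nC[k+1]≡[n+1]C[k+1] e k) | ℤP.pos-+ (e C k) (e C suc k)
        = trans (ℤP.*-distribʳ-+ c (+ (e C k)) (+ (e C suc k)))
                (ℤP.+-comm (+ (e C k) * c) (+ (e C suc k) * c))
      same : ∀ i → coef (hasse (suc k) (a ∷ as)) i ≡ coef ((0ℤ ∷ hasse (suc k) as) +ₚ hasse k as) i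
      same zero rewrite coef-hasse (suc k) (a ∷ as) 0 | coef-+ₚ (0ℤ ∷ hasse (suc k) as) (hasse k as) 0
                      | coef-hasse k as 0 | ℕP.+-identityʳ k | nCn≡1 k | nCn≡1 (suc k)
                      = sym (ℤP.+-identityˡ _)
      same (suc i) =
        begin
          coef (hasse (suc k) (a ∷ as)) (suc i)
        ≡⟨ coef-hasse (suc k) (a ∷ as) (suc i) ⟩
          + ((suc k ℕ.+ suc i) C suc k) * coef as (k ℕ.+ suc i)
        ≡⟨ pascal (k ℕ.+ suc i) k (coef as (k ℕ.+ suc i)) ⟩
          + ((k ℕ.+ suc i) C suc k) * coef as (k ℕ.+ suc i) + + ((k ℕ.+ suc i) C k) * coef as (k ℕ.+ suc i)
        ≡⟨ cong (λ e → + (e C suc k) * coef as e + + ((k ℕ.+ suc i) C k) * coef as (k ℕ.+ suc i)) (ℕP.+-suc k i) ⟩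
          + ((suc k ℕ.+ i) C suc k) * coef as (suc k ℕ.+ i) + + ((k ℕ.+ suc i) C k) * coef as (k ℕ.+ suc i)
        ≡⟨ sym (cong₂ _+_ (coef-hasse (suc k) as i) (coef-hasse k as (suc i))) ⟩
          coef (hasse (suc k) as) i + coef (hasse k as) (suc i)
        ≡⟨ sym (coef-+ₚ (0ℤ ∷ hasse (suc k) as) (hasse k as) (suc i)) ⟩
          coef ((0ℤ ∷ hasse (suc k) as) +ₚ hasse k as) (suc i)
        ∎
        where open ≡-Reasoning

  taylor-const : ∀ k a t → taylor (suc k) (a ∷ []) t ≡ 0ℤ
  taylor-const k a t rewrite taylor-cons k a [] t | taylor-[] (suc k) t | taylor-[] k t
    = trans (ℤP.+-identityʳ (t * 0ℤ)) (ℤP.*-zeroʳ t)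

module Substitution where

  open Polynomials
  open import Data.Nat as ℕ using (ℕ; zero; suc)
  import Data.Nat.Properties as ℕP
  open import Data.Nat.Combinatorics using (_C_)
  open import Data.Integer using (ℤ; +_; _+_; _*_; _-_; 0ℤ; 1ℤ; _^_)
  import Data.Integer.Properties as ℤP
  open import Data.Integer.Divisibility.Signed as S using (divides; ∣ᵤ⇒∣) renaming (_∣_ to _∣ˢ_)
  import Data.Integer.Divisibility as U
  open import Data.Integer.Tactic.RingSolver using (solve-∀)
  open import Data.List using ([]; _∷_)
  open import Relation.Binary.PropositionalEquality using (_≡_; refl; sym; trans; cong; cong₂; subst; module ≡-Reasoning)
  open import Relation.Nullary using (yes; no)
  open import Data.Product using (_,_)

  coef-compLin : ∀ h r d n → coef (compLin h r d) n ≡ taylor n h r * d ^ n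
  coef-compLin [] r d n = sym (trans (cong (_* d ^ n) (taylor-[] n r)) (ℤP.*-zeroˡ (d ^ n)))
  coef-compLin (a ∷ h) r d zero =
    begin
      coef ((a ∷ []) +ₚ (scale r G +ₚ (0ℤ ∷ scale d G))) 0
    ≡⟨ coef-+ₚ (a ∷ []) (scale r G +ₚ (0ℤ ∷ scale d G)) 0 ⟩
      a + coef (scale r G +ₚ (0ℤ ∷ scale d G)) 0
    ≡⟨ cong (λ v → a + v) (coef-+ₚ (scale r G) (0ℤ ∷ scale d G) 0) ⟩
      a + (coef (scale r G) 0 + 0ℤ)
    ≡⟨ cong (λ v → a + (v + 0ℤ)) (coef-scale r G 0) ⟩
      a + (r * coef G 0 + 0ℤ)
    ≡⟨ cong (λ v → a + (r * v + 0ℤ)) (coef-compLin h r d 0) ⟩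
      a + (r * (taylor 0 h r * 1ℤ) + 0ℤ)
    ≡⟨ cong (λ v → a + (r * (v * 1ℤ) + 0ℤ)) (taylor-0 h r) ⟩
      a + (r * (eval h r * 1ℤ) + 0ℤ)
    ≡⟨ identity a r (eval h r) ⟩
      eval (a ∷ h) r * 1ℤ
    ≡⟨ cong (_* 1ℤ) (sym (taylor-0 (a ∷ h) r)) ⟩
      taylor 0 (a ∷ h) r * 1ℤ
    ∎
    where
      open ≡-Reasoning
      G = compLin h r d
      identity : ∀ a r E → a + (r * (E * 1ℤ) + 0ℤ) ≡ (a + r * E) * 1ℤ
      identity = solve-∀
  coef-compLin (a ∷ h) r d (suc k) =
    begin
      coef ((a ∷ []) +ₚ (scale r G +ₚ (0ℤ ∷ scale d G))) (suc k)
    ≡⟨ coef-+ₚ (a ∷ []) (scale r G +ₚ (0ℤ ∷ scale d G)) (suc k) ⟩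
      0ℤ + coef (scale r G +ₚ (0ℤ ∷ scale d G)) (suc k)
    ≡⟨ cong (λ v → 0ℤ + v) (coef-+ₚ (scale r G) (0ℤ ∷ scale d G) (suc k)) ⟩
      0ℤ + (coef (scale r G) (suc k) + coef (scale d G) k)
    ≡⟨ cong₂ (λ v w → 0ℤ + (v + w)) (coef-scale r G (suc k)) (coef-scale d G k) ⟩
      0ℤ + (r * coef G (suc k) + d * coef G k)
    ≡⟨ cong₂ (λ v w → 0ℤ + (r * v + d * w)) (coef-compLin h r d (suc k)) (coef-compLin h r d k) ⟩
      0ℤ + (r * (taylor (suc k) h r * (d * d ^ k)) + d * (taylor k h r * d ^ k))
    ≡⟨ identity r d (taylor (suc k) h r) (taylor k h r) (d ^ k) ⟩
      (r * taylor (suc k) h r + taylor k h r) * (d * d ^ k)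
    ≡⟨ cong (_* (d * d ^ k)) (sym (taylor-cons k a h r)) ⟩
      taylor (suc k) (a ∷ h) r * d ^ suc k
    ∎
    where
      open ≡-Reasoning
      G = compLin h r d
      identity : ∀ r d X Y D → 0ℤ + (r * (X * (d * D)) + d * (Y * D)) ≡ (r * X + Y) * (d * D)
      identity = solve-∀

  taylor-compLin : ∀ k h u w x → taylor k (compLin h u w) x ≡ w ^ k * taylor k h (u + w * x)
  taylor-compLin zero h u w x =
    trans (taylor-0 (compLin h u w) x)
      (trans (eval-compLin h u w x) (trans (sym (taylor-0 h (u + w * x))) (sym (ℤP.*-identityˡ _))))
  taylor-compLin (suc k) [] u w x = sym (ℤP.*-zeroʳ (w ^ suc k))
  taylor-compLin (suc k) (a ∷ h) u w x =
    begin
      taylor (suc k) ((a ∷ []) +ₚ (scale u G +ₚ (0ℤ ∷ scale w G))) x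
    ≡⟨ taylor-+ₚ (suc k) (a ∷ []) (scale u G +ₚ (0ℤ ∷ scale w G)) x ⟩
      taylor (suc k) (a ∷ []) x + taylor (suc k) (scale u G +ₚ (0ℤ ∷ scale w G)) x
    ≡⟨ cong₂ _+_ (taylor-const k a x) (taylor-+ₚ (suc k) (scale u G) (0ℤ ∷ scale w G) x) ⟩
      0ℤ + (taylor (suc k) (scale u G) x + taylor (suc k) (0ℤ ∷ scale w G) x)
    ≡⟨ cong₂ (λ v v' → 0ℤ + (v + v')) (taylor-scale (suc k) u G x) (taylor-cons k 0ℤ (scale w G) x) ⟩
      0ℤ + (u * taylor (suc k) G x + (x * taylor (suc k) (scale w G) x + taylor k (scale w G) x))
    ≡⟨ cong₂ (λ v v' → 0ℤ + (u * taylor (suc k) G x + (x * v + v'))) (taylor-scale (suc k) w G x) (taylor-scale k w G x) ⟩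
      0ℤ + (u * taylor (suc k) G x + (x * (w * taylor (suc k) G x) + w * taylor k G x))
    ≡⟨ cong₂ (λ v v' → 0ℤ + (u * v + (x * (w * v) + w * v'))) (taylor-compLin (suc k) h u w x) (taylor-compLin k h u w x) ⟩
      0ℤ + (u * (w * w ^ k * T₁) + (x * (w * (w * w ^ k * T₁)) + w * (w ^ k * T₀)))
    ≡⟨ identity u w x (w ^ k) T₁ T₀ ⟩
      w * w ^ k * ((u + w * x) * T₁ + T₀)
    ≡⟨ cong (w * w ^ k *_) (sym (taylor-cons k a h (u + w * x))) ⟩
      w ^ suc k * taylor (suc k) (a ∷ h) (u + w * x)
    ∎
    where
      open ≡-Reasoning
      G = compLin h u w
      T₁ = taylor (suc k) h (u + w * x)
      T₀ = taylor k h (u + w * x)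
      identity : ∀ u w x W T₁ T₀ → 0ℤ + (u * (w * W * T₁) + (x * (w * (w * W * T₁)) + w * (W * T₀)))
                                   ≡ w * W * ((u + w * x) * T₁ + T₀)
      identity = solve-∀

  ∣-eval : ∀ M P t → (∀ i → M ∣ˢ coef P i) → M ∣ˢ eval P t
  ∣-eval M []      t M∣P = divides 0ℤ (sym (ℤP.*-zeroˡ M))
  ∣-eval M (a ∷ P) t M∣P = S.∣m∣n⇒∣m+n (M∣P 0) (S.∣n⇒∣m*n t (∣-eval M P t (λ i → M∣P (suc i))))

  pos-^ : ∀ a n → + (a ℕ.^ n) ≡ (+ a) ^ n
  pos-^ a zero    = refl
  pos-^ a (suc n) = trans (ℤP.pos-* a (a ℕ.^ n)) (cong (+ a *_) (pos-^ a n))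

  ^-distribʳ-* : ∀ a b n → (a * b) ^ n ≡ a ^ n * b ^ n
  ^-distribʳ-* a b zero    = refl
  ^-distribʳ-* a b (suc n) rewrite ^-distribʳ-* a b n = identity a b (a ^ n) (b ^ n)
    where
      identity : ∀ a b x y → a * b * (x * y) ≡ a * x * (b * y)
      identity = solve-∀

  ^-monoʳ-∣ˢ : ∀ x a b → a ℕ.≤ b → x ^ a ∣ˢ x ^ b
  ^-monoʳ-∣ˢ x a b a≤b with ℕP.m≤n⇒∃[o]m+o≡n a≤b
  ... | c , refl = divides (x ^ c) (trans (ℤP.^-distribˡ-+-* x a c) (ℤP.*-comm (x ^ a) (x ^ c)))

  toSigned : ∀ p n x → + (p ℕ.^ n) U.∣ x → (+ p) ^ n ∣ˢ x
  toSigned p n x pⁿ∣x = subst (_∣ˢ x) (pos-^ p n) (∣ᵤ⇒∣ pⁿ∣x)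

  digit-cong : ∀ {p} (z : ℤₚ p) j k → (+ p) ^ j ∣ˢ (+ digit z (j ℕ.+ k) - + digit z j)
  digit-cong {p} z j zero rewrite ℕP.+-identityʳ j =
    subst ((+ p) ^ j ∣ˢ_) (sym (ℤP.+-inverseʳ (+ digit z j))) (divides 0ℤ (sym (ℤP.*-zeroˡ ((+ p) ^ j))))
  digit-cong {p} z j (suc k) rewrite ℕP.+-suc j k =
    subst ((+ p) ^ j ∣ˢ_) (telescope (+ digit z (suc (j ℕ.+ k))) (+ digit z (j ℕ.+ k)) (+ digit z j))
      (S.∣m∣n⇒∣m+n (S.∣-trans (^-monoʳ-∣ˢ (+ p) j (j ℕ.+ k) (ℕP.m≤m+n j k)) (toSigned p (j ℕ.+ k) (+ digit z (suc (j ℕ.+ k)) - + digit z (j ℕ.+ k)) (compat z (j ℕ.+ k))))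
                   (digit-cong z j k))
    where
      telescope : ∀ a b c → (a - b) + (b - c) ≡ a - c
      telescope = solve-∀

  -- Proof: expand h around a digit u ≡ t
  -- (mod p^e) of z that is accurate modulo p^(e + e m).
  rootPower∣coef : (h : Poly) (p : ℕ) (z : ℤₚ p) (m : ℕ)
    (vanish : ∀ n → n ℕ.< m → VanishesAt p (hasse n h) z)
    (e : ℕ) (t : ℤ) → + (p ℕ.^ e) U.∣ (t - + digit z e) → (d' : ℕ) →
    ∀ k → (+ p) ^ (e ℕ.* m) ∣ˢ coef (compLin h t (+ (p ℕ.^ e ℕ.* d'))) k
  rootPower∣coef h p z m vanish e t t≡z d' k =
    subst (M ∣ˢ_) (sym coefₖ≡) (S.∣m⇒∣m*n ((+ d') ^ k) M∣taylorₖ)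
    where
      P = (+ p) ^ e
      M = (+ p) ^ (e ℕ.* m)
      J = e ℕ.+ e ℕ.* m
      u = + digit z J
      P∣t-u : P ∣ˢ (t - u)
      P∣t-u = subst (P ∣ˢ_) (cancel t u (+ digit z e))
                (S.∣m∣n⇒∣m-n (toSigned p e (t - + digit z e) t≡z) (digit-cong z e (e ℕ.* m)))
        where
          cancel : ∀ t a b → (t - b) - (a - b) ≡ t - a
          cancel = solve-∀
      s = S._∣_.quotient P∣t-u
      t≡u+Ps : t ≡ u + P * s
      t≡u+Ps = rearrange t u s P (S._∣_.equality P∣t-u)
        where
          rearrange : ∀ t u s P → t - u ≡ s * P → t ≡ u + P * s
          rearrange t u s P eq = begin
              t             ≡⟨ split t u ⟩
              u + (t - u)   ≡⟨ cong (λ v → u + v) eq ⟩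
              u + s * P     ≡⟨ cong (λ v → u + v) (ℤP.*-comm s P) ⟩
              u + P * s     ∎
            where
              open ≡-Reasoning
              split : ∀ t u → t ≡ u + (t - u)
              split = solve-∀
      g = compLin h u P
      M∣coef-g : ∀ n → M ∣ˢ coef g n
      M∣coef-g n with n ℕ.<? m
      ... | yes n<m = subst (M ∣ˢ_) (sym (coef-compLin h u P n))
            (S.∣m⇒∣m*n (P ^ n) (S.∣-trans (^-monoʳ-∣ˢ (+ p) (e ℕ.* m) J (ℕP.m≤n+m (e ℕ.* m) e))
               (toSigned p J (taylor n h u) (vanish n n<m J))))
      ... | no n≮m = subst (M ∣ˢ_) (sym (coef-compLin h u P n))
            (S.∣n⇒∣m*n (taylor n h u) (subst (M ∣ˢ_) (sym (ℤP.^-*-assoc (+ p) e n))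
               (^-monoʳ-∣ˢ (+ p) (e ℕ.* m) (e ℕ.* n) (ℕP.*-monoʳ-≤ e (ℕP.≮⇒≥ n≮m)))))
      M∣taylorₖ : M ∣ˢ taylor k g s
      M∣taylorₖ = ∣-eval M (hasse k g) s (λ i → subst (M ∣ˢ_) (sym (coef-hasse k g i))
                    (S.∣n⇒∣m*n (+ ((k ℕ.+ i) C k)) (M∣coef-g (k ℕ.+ i))))
      coefₖ≡ : coef (compLin h t (+ (p ℕ.^ e ℕ.* d'))) k ≡ taylor k g s * (+ d') ^ k
      coefₖ≡ = begin
          coef (compLin h t (+ (p ℕ.^ e ℕ.* d'))) k
        ≡⟨ coef-compLin h t (+ (p ℕ.^ e ℕ.* d')) k ⟩
          taylor k h t * (+ (p ℕ.^ e ℕ.* d')) ^ k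
        ≡⟨ cong (λ v → taylor k h t * v ^ k) (trans (ℤP.pos-* (p ℕ.^ e) d') (cong (_* + d') (pos-^ p e))) ⟩
          taylor k h t * (P * + d') ^ k
        ≡⟨ cong (taylor k h t *_) (^-distribʳ-* P (+ d') k) ⟩
          taylor k h t * (P ^ k * (+ d') ^ k)
        ≡⟨ reassoc (taylor k h t) (P ^ k) ((+ d') ^ k) ⟩
          P ^ k * taylor k h t * (+ d') ^ k
        ≡⟨ cong (λ v → P ^ k * taylor k h v * (+ d') ^ k) t≡u+Ps ⟩
          P ^ k * taylor k h (u + P * s) * (+ d') ^ k
        ≡⟨ cong (_* (+ d') ^ k) (sym (taylor-compLin k h u P s)) ⟩
          taylor k g s * (+ d') ^ k
        ∎
        where
          open ≡-Reasoning
          reassoc : ∀ A B C → A * (B * C) ≡ B * A * C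
          reassoc = solve-∀

module Multiplicative where

  open import Data.Nat using (ℕ; zero; suc; _*_; _^_; _≤_; _≟_; nonTrivial⇒n>1; >-nonZero)
  open import Data.Nat.Properties
  open import Data.Nat.Divisibility
  open import Data.Nat.Primality
  open import Data.Nat.Primality.Factorisation
  open import Data.List using ([]; _∷_)
  open import Data.Nat.ListAction using (product)
  open import Data.List.Relation.Unary.All using (All; []; _∷_)
  open import Relation.Binary.PropositionalEquality using (_≡_; refl; sym; trans; cong; subst)
  open import Relation.Nullary using (¬_; yes; no)
  open import Data.Empty using (⊥-elim)
  open import Data.Product using (_×_; _,_; Σ)
  open import Data.Sum using (inj₁; inj₂)

  prime≥1 : ∀ {p} → Prime p → 1 ≤ p
  prime≥1 {p} (prime _) = <⇒≤ (nonTrivial⇒n>1 p)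

  prime∤1 : ∀ {p} → Prime p → ¬ (p ∣ 1)
  prime∤1 {p} (prime _) p∣1 with ∣1⇒≡1 p∣1
  ... | refl = <-irrefl refl (nonTrivial⇒n>1 p)

  prime∣prime⇒≡ : ∀ {p q} → Prime p → Prime q → p ∣ q → p ≡ q
  prime∣prime⇒≡ pp qq p∣q with prime⇒irreducible qq p∣q
  ... | inj₁ refl = ⊥-elim (prime∤1 pp (1∣ 1))
  ... | inj₂ p≡q  = p≡q

  prime∣^⇒∣ : ∀ {q p} → Prime q → ∀ m → q ∣ p ^ m → q ∣ p
  prime∣^⇒∣ qq zero    q∣1 = ⊥-elim (prime∤1 qq q∣1)
  prime∣^⇒∣ {q} {p} qq (suc m) q∣pᵐ⁺¹ with euclidsLemma p (p ^ m) qq q∣pᵐ⁺¹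
  ... | inj₁ q∣p  = q∣p
  ... | inj₂ q∣pᵐ = prime∣^⇒∣ qq m q∣pᵐ

  1≤^ : ∀ b k → 1 ≤ b → 1 ≤ b ^ k
  1≤^ b zero    _   = ≤-refl
  1≤^ b (suc k) 1≤b = *-mono-≤ 1≤b (1≤^ b k 1≤b)

  ^-monoʳ-∣ : ∀ x a b → a ≤ b → x ^ a ∣ x ^ b
  ^-monoʳ-∣ x a b a≤b with m≤n⇒∃[o]m+o≡n a≤b
  ... | c , refl = divides (x ^ c) (trans (^-distribˡ-+-* x a c) (*-comm (x ^ a) (x ^ c)))

  prime-induction : (P : ℕ → Set) → P 1 → (∀ p n → Prime p → 1 ≤ n → P n → P (p * n)) →
                    ∀ n → 1 ≤ n → P n
  prime-induction P P1 step n 1≤n =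
    subst P (sym (PrimeFactorisation.isFactorisation f)) (go (factors f) (PrimeFactorisation.factorsPrime f))
    where
      f = factorise n {{>-nonZero 1≤n}}
      go : ∀ fs → All Prime fs → P (product fs)
      go []       []         = P1
      go (p ∷ fs) (pp ∷ pfs) = step p (product fs) pp (productOfPrimes≥1 pfs) (go fs pfs)

  PPart : ℕ → ℕ → Set
  PPart p n = Σ ℕ λ e → Σ ℕ λ d' → (n ≡ p ^ e * d') × ¬ (p ∣ d') × 1 ≤ d'

  pPart : ∀ p → Prime p → ∀ n → 1 ≤ n → PPart p n
  pPart p pp = prime-induction (PPart p) (0 , 1 , refl , prime∤1 pp , ≤-refl) step
    where
      step : ∀ q n → Prime q → 1 ≤ n → PPart p n → PPart p (q * n)
      step q n qq 1≤n (e , d' , n≡ , p∤d' , 1≤d') with q ≟ p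
      ... | yes refl = suc e , d' , trans (cong (q *_) n≡) (sym (*-assoc q (q ^ e) d')) , p∤d' , 1≤d'
      ... | no q≢p = e , q * d' , qn≡ , p∤qd' , *-mono-≤ (prime≥1 qq) 1≤d'
        where
          qn≡ : q * n ≡ p ^ e * (q * d')
          qn≡ = trans (cong (q *_) n≡) (trans (sym (*-assoc q (p ^ e) d'))
                  (trans (cong (_* d') (*-comm q (p ^ e))) (*-assoc (p ^ e) q d')))
          p∤qd' : ¬ (p ∣ q * d')
          p∤qd' p∣qd' with euclidsLemma q d' pp p∣qd'
          ... | inj₁ p∣q  = q≢p (sym (prime∣prime⇒≡ pp qq p∣q))
          ... | inj₂ p∣d' = p∤d' p∣d'

  p^suc∤ : ∀ {p} → Prime p → ∀ e d' → ¬ (p ∣ d') → ¬ (p ^ suc e ∣ p ^ e * d')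
  p^suc∤ {p} pp e d' p∤d' p^suc∣ = p∤d' (*-cancelˡ-∣ (p ^ e) {{m^n≢0 p e {{prime⇒nonZero pp}}}}
    (subst (_∣ p ^ e * d') (*-comm p (p ^ e)) p^suc∣))

  p^∣-cancel : ∀ {p y} → Prime p → ¬ (p ∣ y) → ∀ j z → p ^ j ∣ y * z → p ^ j ∣ z
  p^∣-cancel pp p∤y zero z _ = 1∣ z
  p^∣-cancel {p} {y} pp p∤y (suc j) z p^suc∣ with euclidsLemma y z pp (∣-trans (m∣m*n (p ^ j)) p^suc∣)
  ... | inj₁ p∣y = ⊥-elim (p∤y p∣y)
  ... | inj₂ (divides c refl) = subst (p * p ^ j ∣_) (*-comm p c) (*-monoʳ-∣ p p^j∣c)
    where
      instance _ = prime⇒nonZero pp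
      p^j∣c : p ^ j ∣ c
      p^j∣c = p^∣-cancel pp p∤y j c (*-cancelˡ-∣ p (subst (p * p ^ j ∣_) reorder p^suc∣))
        where
          reorder : y * (c * p) ≡ p * (y * c)
          reorder = trans (cong (y *_) (*-comm c p)) (trans (sym (*-assoc y p c))
                      (trans (cong (_* c) (*-comm y p)) (*-assoc p y c)))

  ∣-from-prime-powers : ∀ d → 1 ≤ d → ∀ X → (∀ p j → Prime p → p ^ j ∣ d → p ^ j ∣ X) → d ∣ X
  ∣-from-prime-powers =
    prime-induction (λ d → ∀ X → (∀ p j → Prime p → p ^ j ∣ d → p ^ j ∣ X) → d ∣ X) (λ X _ → 1∣ X) step
    where
      step : ∀ q n → Prime q → 1 ≤ n →
             (∀ X → (∀ p j → Prime p → p ^ j ∣ n → p ^ j ∣ X) → n ∣ X) →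
             ∀ X → (∀ p j → Prime p → p ^ j ∣ q * n → p ^ j ∣ X) → q * n ∣ X
      step q n qq 1≤n ih X local with subst (_∣ X) (*-identityʳ q) (local q 1 qq (*-monoʳ-∣ q (1∣ n)))
      ... | divides c refl = subst (q * n ∣_) (*-comm q c) (*-monoʳ-∣ q (ih c local′))
        where
          local′ : ∀ p j → Prime p → p ^ j ∣ n → p ^ j ∣ c
          local′ p j pp p^j∣n with p ≟ q
          ... | yes refl = *-cancelˡ-∣ p {{prime⇒nonZero pp}}
                             (subst (p * p ^ j ∣_) (*-comm c p) (local p (suc j) pp (*-monoʳ-∣ p p^j∣n)))
          ... | no p≢q = p^∣-cancel pp (λ p∣q → p≢q (prime∣prime⇒≡ pp qq p∣q)) j c
                           (subst (p ^ j ∣_) (*-comm c q) (local p j pp (∣-trans p^j∣n (n∣m*n q))))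

module LambdaFunction where

  open Multiplicative
  open import Data.Nat using (zero; suc; _*_; _^_; _≤_)
  open import Data.Nat.Properties
  open import Data.Nat.Divisibility
  open import Data.Nat.Primality
  open import Relation.Binary.PropositionalEquality using (_≡_; refl; sym; trans; cong; cong₂; subst; module ≡-Reasoning)
  open import Data.Empty using (⊥-elim)
  open import Data.Sum using (inj₁; inj₂)

  module _ {h : Poly} (D : RootData h) where

    lam-^ : ∀ b k → 1 ≤ b → lam D (b ^ k) ≡ lam D b ^ k
    lam-^ b zero    _   = lam-one D
    lam-^ b (suc k) 1≤b = trans (lam-mul D b (b ^ k) 1≤b (1≤^ b k 1≤b)) (cong (lam D b *_) (lam-^ b k 1≤b))

    lam-prime^ : ∀ p (pp : Prime p) k → lam D (p ^ k) ≡ p ^ (mult D p pp * k)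
    lam-prime^ p pp k = trans (lam-^ p k (prime≥1 pp))
      (trans (cong (_^ k) (lam-prime D p pp)) (^-*-assoc p (mult D p pp) k))

    lam-pos : ∀ n → 1 ≤ n → 1 ≤ lam D n
    lam-pos = prime-induction (λ n → 1 ≤ lam D n) (subst (1 ≤_) (sym (lam-one D)) ≤-refl) step
      where
        step : ∀ p n → Prime p → 1 ≤ n → 1 ≤ lam D n → 1 ≤ lam D (p * n)
        step p n pp 1≤n 1≤λn = subst (1 ≤_) (sym (lam-mul D p n (prime≥1 pp) 1≤n))
          (*-mono-≤ (subst (1 ≤_) (sym (lam-prime D p pp)) (1≤^ p (mult D p pp) (prime≥1 pp))) 1≤λn)

    prime∣lam⇒prime∣ : ∀ q → Prime q → ∀ a → 1 ≤ a → q ∣ lam D a → q ∣ a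
    prime∣lam⇒prime∣ q qq = prime-induction (λ a → q ∣ lam D a → q ∣ a) base step
      where
        base : q ∣ lam D 1 → q ∣ 1
        base q∣λ1 = ⊥-elim (prime∤1 qq (subst (q ∣_) (lam-one D) q∣λ1))
        step : ∀ p n → Prime p → 1 ≤ n → (q ∣ lam D n → q ∣ n) → q ∣ lam D (p * n) → q ∣ p * n
        step p n pp 1≤n ih q∣λpn
          with euclidsLemma (p ^ mult D p pp) (lam D n) qq
                 (subst (q ∣_) (trans (lam-mul D p n (prime≥1 pp) 1≤n) (cong (_* lam D n) (lam-prime D p pp))) q∣λpn)
        ... | inj₁ q∣pᵐ = ∣m⇒∣m*n n (prime∣^⇒∣ qq (mult D p pp) q∣pᵐ)
        ... | inj₂ q∣λn = ∣n⇒∣m*n p (ih q∣λn)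

  -- two such functions commute under composition: both are determined by
  -- their values p^(m_p m'_p) on primes
  lam-comm : ∀ {h h'} (D : RootData h) (E : RootData h') n → 1 ≤ n →
             lam D (lam E n) ≡ lam E (lam D n)
  lam-comm D E = prime-induction (λ n → lam D (lam E n) ≡ lam E (lam D n)) base step
    where
      base : lam D (lam E 1) ≡ lam E (lam D 1)
      base rewrite lam-one E | lam-one D | lam-one E = refl
      onPrime : ∀ p (pp : Prime p) → lam D (lam E p) ≡ lam E (lam D p)
      onPrime p pp = begin
          lam D (lam E p)                    ≡⟨ cong (lam D) (lam-prime E p pp) ⟩
          lam D (p ^ mult E p pp)            ≡⟨ lam-prime^ D p pp (mult E p pp) ⟩
          p ^ (mult D p pp * mult E p pp)    ≡⟨ cong (p ^_) (*-comm (mult D p pp) (mult E p pp)) ⟩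
          p ^ (mult E p pp * mult D p pp)    ≡⟨ sym (lam-prime^ E p pp (mult D p pp)) ⟩
          lam E (p ^ mult D p pp)            ≡⟨ cong (lam E) (sym (lam-prime D p pp)) ⟩
          lam E (lam D p)                    ∎
        where open ≡-Reasoning
      step : ∀ p n → Prime p → 1 ≤ n → lam D (lam E n) ≡ lam E (lam D n) →
             lam D (lam E (p * n)) ≡ lam E (lam D (p * n))
      step p n pp 1≤n ih = begin
          lam D (lam E (p * n))               ≡⟨ cong (lam D) (lam-mul E p n 1≤p 1≤n) ⟩
          lam D (lam E p * lam E n)           ≡⟨ lam-mul D (lam E p) (lam E n) (lam-pos E p 1≤p) (lam-pos E n 1≤n) ⟩
          lam D (lam E p) * lam D (lam E n)   ≡⟨ cong₂ _*_ (onPrime p pp) ih ⟩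
          lam E (lam D p) * lam E (lam D n)   ≡⟨ sym (lam-mul E (lam D p) (lam D n) (lam-pos D p 1≤p) (lam-pos D n 1≤n)) ⟩
          lam E (lam D p * lam D n)           ≡⟨ cong (lam E) (sym (lam-mul D p n 1≤p 1≤n)) ⟩
          lam E (lam D (p * n))               ∎
        where
          open ≡-Reasoning
          1≤p = prime≥1 pp

module ShiftedPolynomials where

  open Polynomials
  open Substitution
  open Multiplicative
  open LambdaFunction
  open import Data.Nat as ℕ using (zero; suc; _≤_; _<_)
  import Data.Nat.Properties as ℕP
  open import Data.Nat.Divisibility as ND using (∣-trans; m∣m*n; n∣m*n)
  open import Data.Nat.Primality using (Prime)
  open import Data.Integer as ℤ using (+_; _+_; _*_; _-_; -_; 0ℤ; _^_)
  import Data.Integer.Properties as ℤP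
  open import Data.Integer.DivMod using (_/ℕ_; _%ℕ_; a≡a%ℕn+[a/ℕn]*n; n%ℕd<d)
  open import Data.Integer.Divisibility.Signed as S using (∣ᵤ⇒∣; ∣⇒∣ᵤ) renaming (_∣_ to _∣ˢ_)
  import Data.Integer.Divisibility as U
  open import Data.Integer.Tactic.RingSolver using (solve-∀)
  open import Data.List using ([]; _∷_; map)
  open import Relation.Binary.PropositionalEquality using (_≡_; refl; sym; trans; cong; cong₂; subst; module ≡-Reasoning)
  open import Relation.Nullary using (¬_; yes; no)
  open import Data.Empty using (⊥-elim)
  open import Data.Product using (_,_; proj₁; proj₂)

  toUnsigned : ∀ p n x → (+ p) ^ n ∣ˢ x → p ℕ.^ n ND.∣ ℤ.∣ x ∣
  toUnsigned p n x pⁿ∣x = subst (λ y → ℤ.∣ y ∣ ND.∣ ℤ.∣ x ∣) (sym (pos-^ p n)) (∣⇒∣ᵤ pⁿ∣x)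

  r-cong-exact : ∀ {h} (D : RootData h) d → 1 ≤ d → ∀ p (pp : Prime p) e d' →
                 d ≡ p ℕ.^ e ℕ.* d' → ¬ (p ND.∣ d') → + (p ℕ.^ e) U.∣ (r D d - + digit (root D p pp) e)
  r-cong-exact D d 1≤d p pp e d' d≡ p∤d' =
    r-cong D d 1≤d p e pp (subst (p ℕ.^ e ND.∣_) (sym d≡) (m∣m*n d'))
      (λ p^suc∣d → p^suc∤ pp e d' p∤d' (subst (p ℕ.^ suc e ND.∣_) d≡ p^suc∣d))

  -- λ(d) divides every coefficient of h(r_d + d x): locally at p, with
  -- d = p^e d', λ(d) contributes p^(e m_p) and r_d ≡ z_p (mod p^e)
  lam∣coef : ∀ h (D : RootData h) d → 1 ≤ d → ∀ k →
             lam D d ND.∣ ℤ.∣ coef (compLin h (r D d) (+ d)) k ∣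
  lam∣coef h D d 1≤d k = ∣-from-prime-powers (lam D d) (lam-pos D d 1≤d) _ local
    where
      local : ∀ p j → Prime p → p ℕ.^ j ND.∣ lam D d → p ℕ.^ j ND.∣ ℤ.∣ coef (compLin h (r D d) (+ d)) k ∣
      local p j pp p^j∣λd with pPart p pp d 1≤d
      ... | e , d' , d≡ , p∤d' , 1≤d' = ∣-trans p^j∣p^em p^em∣coef
        where
          m = mult D p pp
          λd≡ : lam D d ≡ lam D d' ℕ.* p ℕ.^ (e ℕ.* m)
          λd≡ = begin
              lam D d                              ≡⟨ cong (lam D) d≡ ⟩
              lam D (p ℕ.^ e ℕ.* d')               ≡⟨ lam-mul D (p ℕ.^ e) d' (1≤^ p e (prime≥1 pp)) 1≤d' ⟩
              lam D (p ℕ.^ e) ℕ.* lam D d'         ≡⟨ cong (ℕ._* lam D d') (lam-prime^ D p pp e) ⟩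
              p ℕ.^ (m ℕ.* e) ℕ.* lam D d'         ≡⟨ cong (λ k → p ℕ.^ k ℕ.* lam D d') (ℕP.*-comm m e) ⟩
              p ℕ.^ (e ℕ.* m) ℕ.* lam D d'         ≡⟨ ℕP.*-comm (p ℕ.^ (e ℕ.* m)) (lam D d') ⟩
              lam D d' ℕ.* p ℕ.^ (e ℕ.* m)         ∎
            where open ≡-Reasoning
          p^j∣p^em : p ℕ.^ j ND.∣ p ℕ.^ (e ℕ.* m)
          p^j∣p^em = p^∣-cancel pp (λ p∣λd' → p∤d' (prime∣lam⇒prime∣ D p pp d' 1≤d' p∣λd')) j _
                       (subst (p ℕ.^ j ND.∣_) λd≡ p^j∣λd)
          p^em∣coef : p ℕ.^ (e ℕ.* m) ND.∣ ℤ.∣ coef (compLin h (r D d) (+ d)) k ∣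
          p^em∣coef = subst (λ n → p ℕ.^ (e ℕ.* m) ND.∣ ℤ.∣ coef (compLin h (r D d) (+ n)) k ∣) (sym d≡)
                        (toUnsigned p (e ℕ.* m) _
                          (rootPower∣coef h p (root D p pp) m (proj₁ (isMult D p pp)) e (r D d)
                            (r-cong-exact D d 1≤d p pp e d' d≡ p∤d') d' k))

  -- r_{Qd} ≡ r_d (mod d): locally, both are ≡ z_p modulo the p-part of d
  r-compat : ∀ h (D : RootData h) d Q → 1 ≤ d → 1 ≤ Q → d ND.∣ ℤ.∣ r D (Q ℕ.* d) - r D d ∣
  r-compat h D d Q 1≤d 1≤Q = ∣-from-prime-powers d 1≤d _ local
    where
      1≤Qd = ℕP.*-mono-≤ 1≤Q 1≤d
      local : ∀ p j → Prime p → p ℕ.^ j ND.∣ d → p ℕ.^ j ND.∣ ℤ.∣ r D (Q ℕ.* d) - r D d ∣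
      local p j pp p^j∣d with pPart p pp d 1≤d | pPart p pp (Q ℕ.* d) 1≤Qd
      ... | e , d₀ , d≡ , p∤d₀ , _ | f , d₁ , Qd≡ , p∤d₁ , _ = ∣-trans p^j∣p^e p^e∣diff
        where
          z = root D p pp
          P = (+ p) ^ e
          p^j∣p^e : p ℕ.^ j ND.∣ p ℕ.^ e
          p^j∣p^e = p^∣-cancel pp p∤d₀ j _ (subst (p ℕ.^ j ND.∣_) (trans d≡ (ℕP.*-comm (p ℕ.^ e) d₀)) p^j∣d)
          e≤f : e ≤ f
          e≤f with e ℕ.≤? f
          ... | yes e≤f = e≤f
          ... | no e≰f = ⊥-elim (p^suc∤ pp f d₁ p∤d₁ (subst (p ℕ.^ suc f ND.∣_) Qd≡
                   (∣-trans (^-monoʳ-∣ p (suc f) e (ℕP.≰⇒> e≰f))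
                     (∣-trans (subst (p ℕ.^ e ND.∣_) (sym d≡) (m∣m*n d₀)) (n∣m*n Q)))))
          rQd≡z : P ∣ˢ (r D (Q ℕ.* d) - + digit z f)
          rQd≡z = S.∣-trans (^-monoʳ-∣ˢ (+ p) e f e≤f)
                    (toSigned p f _ (r-cong-exact D (Q ℕ.* d) 1≤Qd p pp f d₁ Qd≡ p∤d₁))
          zf≡ze : P ∣ˢ (+ digit z f - + digit z e)
          zf≡ze = subst (λ f → P ∣ˢ (+ digit z f - + digit z e)) (proj₂ (ℕP.m≤n⇒∃[o]m+o≡n e≤f))
                    (digit-cong z e (proj₁ (ℕP.m≤n⇒∃[o]m+o≡n e≤f)))
          rd≡z : P ∣ˢ (r D d - + digit z e)
          rd≡z = toSigned p e _ (r-cong-exact D d 1≤d p pp e d₀ d≡ p∤d₀)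
          telescope : ∀ a b c c' → (a - c) + (c - c') - (b - c') ≡ a - b
          telescope = solve-∀
          p^e∣diff : p ℕ.^ e ND.∣ ℤ.∣ r D (Q ℕ.* d) - r D d ∣
          p^e∣diff = toUnsigned p e _ (subst (P ∣ˢ_) (telescope (r D (Q ℕ.* d)) (r D d) (+ digit z f) (+ digit z e))
                       (S.∣m∣n⇒∣m-n (S.∣m∣n⇒∣m+n rQd≡z zf≡ze) rd≡z))

  divBy-exact : ∀ c L → 1 ≤ L → L ND.∣ ℤ.∣ c ∣ → divBy c L * + L ≡ c
  divBy-exact c (suc l) _ L∣c =
    trans (sym (ℤP.+-identityˡ _)) (trans (cong (_+ (c /ℕ L) * + L) (sym rem≡0)) (sym (a≡a%ℕn+[a/ℕn]*n c L)))
    where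
      L = suc l
      L∣rem : + L ∣ˢ + (c %ℕ L)
      L∣rem = subst (+ L ∣ˢ_) (sym (rem≡ c (+ (c %ℕ L)) ((c /ℕ L) * + L) (a≡a%ℕn+[a/ℕn]*n c L)))
                (S.∣m∣n⇒∣m-n (∣ᵤ⇒∣ {+ L} {c} L∣c) (S.∣n⇒∣m*n (c /ℕ L) S.∣-refl))
        where
          rem≡ : ∀ c r q → c ≡ r + q → r ≡ c - q
          rem≡ c r q c≡ = trans (sym (ℤP.+-identityʳ r)) (trans (cong (λ v → r + v) (sym (ℤP.+-inverseʳ q)))
                            (trans (sym (ℤP.+-assoc r q (- q))) (cong (_- q) (sym c≡))))
      small-multiple : ∀ r → r < L → L ND.∣ r → r ≡ 0
      small-multiple zero    _   _   = refl
      small-multiple (suc r) r<L L∣r = ⊥-elim (ℕP.<⇒≱ r<L (ND.∣⇒≤ L∣r))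
      rem≡0 : + (c %ℕ L) ≡ 0ℤ
      rem≡0 = cong +_ (small-multiple (c %ℕ L) (n%ℕd<d c L) (∣⇒∣ᵤ L∣rem))

  eval-divBy : ∀ P L t → 1 ≤ L → (∀ i → L ND.∣ ℤ.∣ coef P i ∣) →
               eval (map (λ c → divBy c L) P) t * + L ≡ eval P t
  eval-divBy []      L t _   _   = refl
  eval-divBy (a ∷ P) L t 1≤L L∣P = begin
      (divBy a L + t * eval P/L t) * + L
    ≡⟨ distrib (divBy a L) t (eval P/L t) (+ L) ⟩
      divBy a L * + L + t * (eval P/L t * + L)
    ≡⟨ cong₂ (λ u v → u + t * v) (divBy-exact a L 1≤L (L∣P 0)) (eval-divBy P L t 1≤L (λ i → L∣P (suc i))) ⟩
      a + t * eval P t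
    ∎
    where
      open ≡-Reasoning
      P/L = map (λ c → divBy c L) P
      distrib : ∀ x t y L → (x + t * y) * L ≡ x * L + t * (y * L)
      distrib = solve-∀

  hd-eval : ∀ h (D : RootData h) d → 1 ≤ d → ∀ t → eval (hd h D d) t * + lam D d ≡ eval h (r D d + + d * t)
  hd-eval h D d 1≤d t = trans (eval-divBy (compLin h (r D d) (+ d)) (lam D d) t (lam-pos D d 1≤d) (lam∣coef h D d 1≤d))
                              (eval-compLin h (r D d) (+ d) t)

module EventualSign where

  open import Data.Nat as ℕ using (ℕ; suc; _≤_; _<_)
  import Data.Nat.Properties as ℕP
  open import Data.Integer as ℤ using (ℤ; +_; -[1+_]; _+_; _*_; -_; 0ℤ; +<+; -<+)
  import Data.Integer.Properties as ℤP
  open import Data.List using ([]; _∷_)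
  open import Relation.Binary.PropositionalEquality using (_≡_; refl; sym; trans; subst)
  open import Relation.Binary.Definitions using (tri<; tri≈; tri>)
  open import Relation.Nullary using (yes; no)
  open import Data.Empty using (⊥-elim)
  open import Data.Product using (_×_; _,_; Σ)

  Eventually : (ℕ → Set) → Set
  Eventually Q = Σ ℕ λ N → ∀ n → N ≤ n → Q n

  Frequently : (ℕ → Set) → Set
  Frequently Q = ∀ N → Σ ℕ λ n → N ≤ n × Q n

  Positive Negative : ℤ → Set
  Positive v = 0ℤ ℤ.< v
  Negative v = v ℤ.< 0ℤ

  +-dominated-pos : ∀ a n E → ℤ.∣ a ∣ < n → Positive E → Positive (a + + n * E)
  +-dominated-pos a n (+ 0)     _     (+<+ ())
  +-dominated-pos a n (+ suc e) |a|<n _ rewrite sym (ℤP.pos-* n (suc e)) =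
    dominate a (n ℕ.* suc e) (ℕP.<-≤-trans |a|<n (ℕP.m≤m*n n (suc e)))
    where
      dominate : ∀ a M → ℤ.∣ a ∣ < M → Positive (a + + M)
      dominate (+ a)    M |a|<M = +<+ (ℕP.<-≤-trans (ℕP.≤-<-trans ℕ.z≤n |a|<M) (ℕP.m≤n+m M a))
      dominate -[1+ a ] M |a|<M rewrite ℤP.⊖-≥ (ℕP.<⇒≤ |a|<M) = +<+ (ℕP.m<n⇒0<n∸m |a|<M)

  +-dominated-neg : ∀ a n E → ℤ.∣ a ∣ < n → Negative E → Negative (a + + n * E)
  +-dominated-neg a n (+ _)    _     (+<+ ())
  +-dominated-neg a n -[1+ e ] |a|<n _ rewrite sym (ℤP.neg-distribʳ-* (+ n) (+ suc e)) | sym (ℤP.pos-* n (suc e)) =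
    dominate a (n ℕ.* suc e) (ℕP.<-≤-trans |a|<n (ℕP.m≤m*n n (suc e)))
    where
      dominate : ∀ a M → ℤ.∣ a ∣ < M → Negative (a + - (+ M))
      dominate (+ a)    (suc M) |a|<M rewrite ℤP.⊖-< |a|<M = neg (suc M ℕ.∸ a) (ℕP.m<n⇒0<n∸m |a|<M)
        where
          neg : ∀ k → 0 < k → Negative (- (+ k))
          neg (suc k) _ = -<+
      dominate -[1+ a ] (suc M) _ = -<+

  record SignFollows (P : Poly) (c : ℤ) : Set where
    field
      pos       : Positive c → Eventually (λ n → Positive (eval P (+ n)))
      neg       : Negative c → Eventually (λ n → Negative (eval P (+ n)))
      vanishing : c ≡ 0ℤ → ∀ t → eval P t ≡ 0ℤ

  -- by induction: a + x P(x) has the eventual sign of P unless P ≡ 0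
  leadSign : ∀ P → SignFollows P (lead P)
  leadSign [] = record { pos = λ { (+<+ ()) } ; neg = λ { (+<+ ()) } ; vanishing = λ _ _ → refl }
  leadSign (a ∷ P) with leadSign P | lead P ℤ.≟ 0ℤ
  ... | IH | yes P≡0 = record
    { pos  = λ a>0 → 0 , λ n _ → subst Positive (sym (constant (+ n))) a>0
    ; neg  = λ a<0 → 0 , λ n _ → subst Negative (sym (constant (+ n))) a<0
    ; vanishing = λ a≡0 t → trans (constant t) a≡0
    }
    where
      constant : ∀ t → eval (a ∷ P) t ≡ a
      constant t rewrite SignFollows.vanishing IH P≡0 t | ℤP.*-zeroʳ t = ℤP.+-identityʳ a
  ... | IH | no P≢0 = record
    { pos  = λ lead>0 → let (N , P>0) = SignFollows.pos IH lead>0 in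
               N ℕ.+ suc ℤ.∣ a ∣ , λ n N≤n →
                 +-dominated-pos a n (eval P (+ n)) (large N n N≤n) (P>0 n (ℕP.≤-trans (ℕP.m≤m+n N _) N≤n))
    ; neg  = λ lead<0 → let (N , P<0) = SignFollows.neg IH lead<0 in
               N ℕ.+ suc ℤ.∣ a ∣ , λ n N≤n →
                 +-dominated-neg a n (eval P (+ n)) (large N n N≤n) (P<0 n (ℕP.≤-trans (ℕP.m≤m+n N _) N≤n))
    ; vanishing = λ lead≡0 → ⊥-elim (P≢0 lead≡0)
    }
    where
      large : ∀ N n → N ℕ.+ suc ℤ.∣ a ∣ ≤ n → ℤ.∣ a ∣ < n
      large N n = ℕP.≤-trans (ℕP.m≤n+m (suc ℤ.∣ a ∣) N)

  frequently-pos⇒lead-pos : ∀ P → Frequently (λ n → Positive (eval P (+ n))) → Positive (lead P)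
  frequently-pos⇒lead-pos P often with ℤP.<-cmp (lead P) 0ℤ
  ... | tri< lead<0 _ _ = let (N , P<0) = SignFollows.neg (leadSign P) lead<0
                              (n , N≤n , P>0) = often N
                          in ⊥-elim (ℤP.<-asym (P<0 n N≤n) P>0)
  ... | tri≈ _ lead≡0 _ = let (n , _ , P>0) = often 0
                          in ⊥-elim (ℤP.<-irrefl (sym (SignFollows.vanishing (leadSign P) lead≡0 (+ n))) P>0)
  ... | tri> _ _ lead>0 = lead>0

  frequently-neg⇒lead-nonpos : ∀ P → Frequently (λ n → Negative (eval P (+ n))) → lead P ℤ.≤ 0ℤ
  frequently-neg⇒lead-nonpos P often = ℤP.≮⇒≥ λ lead>0 →
    let (N , P>0) = SignFollows.pos (leadSign P) lead>0
        (n , N≤n , P<0) = often N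
    in ℤP.<-asym (P>0 n N≤n) P<0

module Transfer where

  open ShiftedPolynomials
  open LambdaFunction
  open EventualSign
  open import Data.Nat as ℕ using (ℕ; zero; suc; _≤_; s≤s; z≤n)
  import Data.Nat.Properties as ℕP
  open import Data.Integer as ℤ using (ℤ; +_; -[1+_]; _+_; _*_; _-_; -_; 0ℤ; 1ℤ; +<+; -<+)
  import Data.Integer.Properties as ℤP
  open import Data.Integer.Divisibility.Signed as S using (∣ᵤ⇒∣) renaming (_∣_ to _∣ˢ_)
  open import Data.Integer.Tactic.RingSolver using (solve-∀)
  open import Relation.Binary.PropositionalEquality using (_≡_; refl; sym; trans; cong; subst; module ≡-Reasoning)
  open import Data.Product using (_×_; _,_; proj₁; proj₂; Σ)
  open import Data.Sum using (_⊎_; inj₁; inj₂)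

  *-pos : ∀ L y → 1 ≤ L → Positive y → Positive (+ L * y)
  *-pos (suc l) (+ suc k) _ _        = +<+ (s≤s z≤n)
  *-pos (suc l) (+ zero)  _ (+<+ ())

  *-neg : ∀ L y → 1 ≤ L → Negative y → Negative (+ L * y)
  *-neg (suc l) -[1+ k ] _ _        = -<+
  *-neg (suc l) (+ k)    _ (+<+ ())

  -- If F(σ n) = L G(n + 1) with L ≥ 1 along arguments σ n ≥ n + 1, then
  -- L I(G) ⊆ I(F): values correspond, and the eventual signs (hence the
  -- signs of the leading coefficients) agree.
  I-scale : ∀ (F G : Poly) L (σ : ℕ → ℕ) → 1 ≤ L → (∀ n → suc n ≤ σ n) →
            (∀ n → eval F (+ σ n) ≡ + L * eval G (+ suc n)) → ∀ y → I G y → I F (+ L * y)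
  I-scale F G L σ 1≤L σ-large F∘σ≡ y ((zero , () , _) , _)
  I-scale F G L σ 1≤L σ-large F∘σ≡ y ((suc n , _ , G≡y) , sign) =
    (σ n , ℕP.≤-trans (s≤s z≤n) (σ-large n) , trans (F∘σ≡ n) (cong (+ L *_) G≡y)) , transferSign sign
    where
      along : (R : ℤ → Set) → (∀ v → R v → R (+ L * v)) →
              Eventually (λ n → R (eval G (+ n))) → Frequently (λ n → R (eval F (+ n)))
      along R R-scale (N , G-R) M =
        σ (M ℕ.+ N) , ℕP.≤-trans (ℕP.m≤m+n M N) (ℕP.≤-trans (ℕP.n≤1+n _) (σ-large (M ℕ.+ N))) ,
        subst R (sym (F∘σ≡ (M ℕ.+ N))) (R-scale _ (G-R _ (ℕP.≤-trans (ℕP.m≤n+m N M) (ℕP.n≤1+n _))))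
      G-neg : lead G ℤ.≤ 0ℤ → Negative y → Negative (lead G)
      G-neg lead≤0 y<0 = ℤP.≤∧≢⇒< lead≤0 λ lead≡0 →
        ℤP.<-irrefl (trans (sym G≡y) (SignFollows.vanishing (leadSign G) lead≡0 (+ suc n))) y<0
      transferSign : (Positive (lead G) × Positive y) ⊎ (lead G ℤ.≤ 0ℤ × Negative y) →
                     (Positive (lead F) × Positive (+ L * y)) ⊎ (lead F ℤ.≤ 0ℤ × Negative (+ L * y))
      transferSign (inj₁ (lead>0 , y>0)) =
        inj₁ (frequently-pos⇒lead-pos F (along Positive (λ v → *-pos L v 1≤L) (SignFollows.pos (leadSign G) lead>0))
             , *-pos L y 1≤L y>0)
      transferSign (inj₂ (lead≤0 , y<0)) =
        inj₂ (frequently-neg⇒lead-nonpos F (along Negative (λ v → *-neg L v 1≤L)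
                (SignFollows.neg (leadSign G) (G-neg lead≤0 y<0)))
             , *-neg L y 1≤L y<0)

  shift : ∀ (r' r : ℤ) (d Q : ℕ) → 1 ≤ d → - + (Q ℕ.* d) ℤ.< r' → r ℤ.≤ 0ℤ → + d ∣ˢ (r' - r) →
          Σ ℕ λ c → 1 ≤ c × (∀ n → r' + + (Q ℕ.* d) * + suc n ≡ r + + d * + (c ℕ.+ Q ℕ.* n))
  shift r' r d Q 1≤d r'>-Qd r≤0 d∣r'-r = c , 1≤c , args≡
    where
      κ = S._∣_.quotient d∣r'-r
      r'-r≡ : r' - r ≡ κ * + d
      r'-r≡ = S._∣_.equality d∣r'-r
      -- (κ + Q) d = (r' + Qd) - r is positive
      X = κ + + Q
      Xd≡ : X * + d ≡ (r' + + (Q ℕ.* d)) + (- r)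
      Xd≡ = trans (ℤP.*-distribʳ-+ (+ d) κ (+ Q))
              (trans (cong (_+ + Q * + d) (sym r'-r≡))
                (trans (cong (λ v → (r' - r) + v) (sym (ℤP.pos-* Q d))) (regroup r' r (+ (Q ℕ.* d)))))
        where
          regroup : ∀ a b c → (a - b) + c ≡ (a + c) + (- b)
          regroup = solve-∀
      Xd>0 : 0ℤ ℤ.< X * + d
      Xd>0 = subst (0ℤ ℤ.<_) (sym Xd≡)
               (ℤP.+-mono-<-≤ (subst (ℤ._< r' + + (Q ℕ.* d)) (ℤP.+-inverseˡ (+ (Q ℕ.* d))) (ℤP.+-monoˡ-< (+ (Q ℕ.* d)) r'>-Qd))
                              (ℤP.neg-mono-≤ r≤0))
      X>0 : 0ℤ ℤ.< X
      X>0 = ℤP.*-cancelʳ-<-nonNeg (+ d) (subst (ℤ._< X * + d) (sym (ℤP.*-zeroˡ (+ d))) Xd>0)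
      positive-nat : ∀ X → 0ℤ ℤ.< X → Σ ℕ λ c → (X ≡ + c) × 1 ≤ c
      positive-nat (+ c) (+<+ 1≤c) = c , refl , 1≤c
      c = proj₁ (positive-nat X X>0)
      X≡c = proj₁ (proj₂ (positive-nat X X>0))
      1≤c = proj₂ (proj₂ (positive-nat X X>0))
      args≡ : ∀ n → r' + + (Q ℕ.* d) * + suc n ≡ r + + d * + (c ℕ.+ Q ℕ.* n)
      args≡ n = begin
          r' + + (Q ℕ.* d) * + suc n
        ≡⟨ cong (λ u → r' + u * + suc n) (ℤP.pos-* Q d) ⟩
          r' + + Q * + d * (1ℤ + + n)
        ≡⟨ cong (λ v → v + + Q * + d * (1ℤ + + n)) (split r' r) ⟩
          (r + (r' - r)) + + Q * + d * (1ℤ + + n)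
        ≡⟨ cong (λ v → (r + v) + + Q * + d * (1ℤ + + n)) r'-r≡ ⟩
          (r + κ * + d) + + Q * + d * (1ℤ + + n)
        ≡⟨ regroup r κ (+ Q) (+ d) (+ n) ⟩
          r + + d * (X + + Q * + n)
        ≡⟨ cong (λ v → r + + d * (v + + Q * + n)) X≡c ⟩
          r + + d * (+ c + + Q * + n)
        ≡⟨ cong (λ v → r + + d * (+ c + v)) (sym (ℤP.pos-* Q n)) ⟩
          r + + d * (+ c + + (Q ℕ.* n))
        ≡⟨ cong (λ v → r + + d * v) (sym (ℤP.pos-+ c (Q ℕ.* n))) ⟩
          r + + d * + (c ℕ.+ Q ℕ.* n)
        ∎
        where
          open ≡-Reasoning
          split : ∀ a b → a ≡ b + (a - b)
          split = solve-∀
          regroup : ∀ r κ q d n → (r + κ * d) + q * d * (1ℤ + n) ≡ r + d * ((κ + q) + q * n)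
          regroup = solve-∀

  hd-rescale : ∀ h (D : RootData h) d Q → 1 ≤ d → 1 ≤ Q → ∀ m n →
               r D (Q ℕ.* d) + + (Q ℕ.* d) * + suc n ≡ r D d + + d * + m →
               eval (hd h D d) (+ m) ≡ + lam D Q * eval (hd h D (Q ℕ.* d)) (+ suc n)
  hd-rescale h D d Q 1≤d 1≤Q m n args≡ =
    ℤP.*-cancelʳ-≡ (eval (hd h D d) (+ m)) (+ lam D Q * E) (+ lam D d) {{ℕ.>-nonZero (lam-pos D d 1≤d)}} (begin
      eval (hd h D d) (+ m) * + lam D d
    ≡⟨ hd-eval h D d 1≤d (+ m) ⟩
      eval h (r D d + + d * + m)
    ≡⟨ cong (eval h) (sym args≡) ⟩
      eval h (r D Qd + + Qd * + suc n)
    ≡⟨ sym (hd-eval h D Qd (ℕP.*-mono-≤ 1≤Q 1≤d) (+ suc n)) ⟩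
      E * + lam D Qd
    ≡⟨ cong (λ v → E * + v) (lam-mul D Q d 1≤Q 1≤d) ⟩
      E * + (lam D Q ℕ.* lam D d)
    ≡⟨ cong (E *_) (ℤP.pos-* (lam D Q) (lam D d)) ⟩
      E * (+ lam D Q * + lam D d)
    ≡⟨ reassoc E (+ lam D Q) (+ lam D d) ⟩
      + lam D Q * E * + lam D d
    ∎)
    where
      open ≡-Reasoning
      Qd = Q ℕ.* d
      E = eval (hd h D Qd) (+ suc n)
      reassoc : ∀ a b c → a * (b * c) ≡ b * a * c
      reassoc = solve-∀

  I-transfer : ∀ h (D : RootData h) d Q → 1 ≤ d → 1 ≤ Q → ∀ y →
               I (hd h D (Q ℕ.* d)) y → I (hd h D d) (+ lam D Q * y)
  I-transfer h D d Q 1≤d 1≤Q =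
    I-scale (hd h D d) (hd h D (Q ℕ.* d)) (lam D Q) (λ n → c ℕ.+ Q ℕ.* n) (lam-pos D Q 1≤Q)
      (λ n → ℕP.+-mono-≤ 1≤c (ℕP.m≤n*m n Q {{ℕ.>-nonZero 1≤Q}}))
      (λ n → hd-rescale h D d Q 1≤d 1≤Q (c ℕ.+ Q ℕ.* n) n (args≡ n))
    where
      shifted : Σ ℕ λ c → 1 ≤ c × (∀ n → r D (Q ℕ.* d) + + (Q ℕ.* d) * + suc n ≡ r D d + + d * + (c ℕ.+ Q ℕ.* n))
      shifted = shift (r D (Q ℕ.* d)) (r D d) d Q 1≤d (proj₁ (r-range D (Q ℕ.* d) (ℕP.*-mono-≤ 1≤Q 1≤d)))
                  (proj₂ (r-range D d 1≤d)) (∣ᵤ⇒∣ (r-compat h D d Q 1≤d 1≤Q))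
      c : ℕ
      c = proj₁ shifted
      1≤c : 1 ≤ c
      1≤c = proj₁ (proj₂ shifted)
      args≡ : ∀ n → r D (Q ℕ.* d) + + (Q ℕ.* d) * + suc n ≡ r D d + + d * + (c ℕ.+ Q ℕ.* n)
      args≡ = proj₂ (proj₂ shifted)

module Compositions where

  open import Data.Nat using (ℕ; zero; suc; _≤_)
  open import Data.Integer using (ℤ; _*_)
  import Data.Integer.Properties as ℤP
  open import Data.Fin using (Fin; zero; suc)
  open import Relation.Binary.PropositionalEquality using (_≡_; refl; sym; trans; cong)
  open import Function using (_∘_)

  compAll-pos : ∀ n (F : Fin n → ℕ → ℕ) → (∀ j x → 1 ≤ x → 1 ≤ F j x) → ∀ x → 1 ≤ x → 1 ≤ compAll n F x
  compAll-pos zero    F pos x 1≤x = 1≤x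
  compAll-pos (suc n) F pos x 1≤x = pos zero _ (compAll-pos n (F ∘ suc) (pos ∘ suc) x 1≤x)

  compOmit-pos : ∀ n (F : Fin n → ℕ → ℕ) → (∀ j x → 1 ≤ x → 1 ≤ F j x) → ∀ i x → 1 ≤ x → 1 ≤ compOmit n F i x
  compOmit-pos (suc n) F pos zero    x 1≤x = compAll-pos n (F ∘ suc) (pos ∘ suc) x 1≤x
  compOmit-pos (suc n) F pos (suc i) x 1≤x = pos zero _ (compOmit-pos n (F ∘ suc) (pos ∘ suc) i x 1≤x)

  compOmit-complete : ∀ n (F : Fin n → ℕ → ℕ) → (∀ j x → 1 ≤ x → 1 ≤ F j x) →
    (∀ i j x → 1 ≤ x → F i (F j x) ≡ F j (F i x)) →
    ∀ i x → 1 ≤ x → F i (compOmit n F i x) ≡ compAll n F x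
  compOmit-complete (suc n) F pos comm zero    x 1≤x = refl
  compOmit-complete (suc n) F pos comm (suc i) x 1≤x =
    trans (comm (suc i) zero _ (compOmit-pos n (F ∘ suc) (pos ∘ suc) i x 1≤x))
          (cong (F zero) (compOmit-complete n (F ∘ suc) (pos ∘ suc) (λ i j → comm (suc i) (suc j)) i x 1≤x))

  sumFin-scale : ∀ n c (f : Fin n → ℤ) → sumFin n (λ i → c * f i) ≡ c * sumFin n f
  sumFin-scale zero    c f = sym (ℤP.*-zeroʳ c)
  sumFin-scale (suc n) c f rewrite sumFin-scale n c (f ∘ suc) = sym (ℤP.*-distribˡ-+ c (f zero) (sumFin n (f ∘ suc)))

module Differences where

  open import Data.Nat as ℕ using (ℕ; suc; _≤_)
  open import Data.Integer using (ℤ; +_; _+_; _*_; _-_; 0ℤ)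
  import Data.Integer.Properties as ℤP
  open import Data.Integer.Tactic.RingSolver using (solve-∀)
  open import Relation.Binary.PropositionalEquality using (_≡_; trans; cong; cong₂)
  open import Data.Sum using (inj₂)

  difference-scale : ∀ (x : ℤ) (Λ a b a₀ b₀ : ℕ) → + a₀ ≡ x + + (Λ ℕ.* a) → + b₀ ≡ x + + (Λ ℕ.* b) →
                     + a₀ - + b₀ ≡ + Λ * (+ a - + b)
  difference-scale x Λ a b a₀ b₀ a₀≡ b₀≡ =
    trans (cong₂ _-_ (trans a₀≡ (cong (λ v → x + v) (ℤP.pos-* Λ a)))
                     (trans b₀≡ (cong (λ v → x + v) (ℤP.pos-* Λ b))))
          (cancel-x x (+ Λ) (+ a) (+ b))
    where
      cancel-x : ∀ x L a b → (x + L * a) - (x + L * b) ≡ L * (a - b)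
      cancel-x = solve-∀

  *-cancel-≡0 : ∀ Λ v → 1 ≤ Λ → + Λ * v ≡ 0ℤ → v ≡ 0ℤ
  *-cancel-≡0 (suc l) v _ Λv≡0 with ℤP.i*j≡0⇒i≡0∨j≡0 (+ suc l) Λv≡0
  ... | inj₂ v≡0 = v≡0

open Transfer
open LambdaFunction
open Compositions
open Differences
open import Data.Nat using (ℕ; _≤_; _*_)
open import Data.Integer using (ℤ; +_; _+_)
import Data.Integer as ℤ
open import Data.Fin using (Fin)
open import Data.Product using (∃; _×_; _,_; proj₂)
open import Relation.Binary.PropositionalEquality using (_≡_; sym; trans; cong; subst)

-- For a, b ∈ A′ with a - b = Σ yᵢ, yᵢ ∈ I(h⁽ⁱ⁾_{λ̃ᵢ(q) dᵢ}), the points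
-- a₀ = x + Λ(q) a and b₀ = x + Λ(q) b of A satisfy a₀ - b₀ = Σ Λ(q) yᵢ, and
-- Λ(q) yᵢ = λᵢ(λ̃ᵢ(q)) yᵢ ∈ I(h⁽ⁱ⁾_{dᵢ}) by the transfer lemma.
proposition5 : (ℓ : ℕ) (h : Fin ℓ → Poly) (inter : ∀ i → Intersective (h i))
    (D : ∀ i → RootData (h i)) (d : Fin ℓ → ℕ) (d-pos : ∀ i → 1 ≤ d i)
    (A : ℕ → Set) (A⊆ℕ : ∀ a → A a → 1 ≤ a)
    (x : ℤ) (q : ℕ) (q-pos : 1 ≤ q)
    (hyp : DiffFree A (SumSet ℓ (λ i → I (hd (h i) (D i) (d i)))))
    (A′ : ℕ → Set) (A′⊆ : ∀ a → A′ a → 1 ≤ a × ∃ λ b → A b × + b ≡ x + + (compAll ℓ (λ i → lam (D i)) q * a)) →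
    DiffFree A′ (SumSet ℓ (λ i → I (hd (h i) (D i) (compOmit ℓ (λ j → lam (D j)) i q * d i))))
proposition5 ℓ h _ D d d-pos A _ x q q-pos hyp A′ A′⊆ a b a∈A′ b∈A′ (ys , ys∈I , a-b≡Σys)
  with proj₂ (A′⊆ a a∈A′) | proj₂ (A′⊆ b b∈A′)
... | a₀ , a₀∈A , a₀≡ | b₀ , b₀∈A , b₀≡ =
  *-cancel-≡0 Λ (+ a ℤ.- + b) (compAll-pos ℓ F λ-pos q q-pos)
    (trans (sym a₀-b₀≡) (hyp a₀ b₀ a₀∈A b₀∈A ((λ i → + Λ ℤ.* ys i) , Λys∈I , a₀-b₀≡Σ)))
  where
    F : Fin ℓ → ℕ → ℕ
    F j = lam (D j)
    Λ = compAll ℓ F q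
    λ-pos : ∀ j n → 1 ≤ n → 1 ≤ F j n
    λ-pos j = lam-pos (D j)
    a₀-b₀≡ : + a₀ ℤ.- + b₀ ≡ + Λ ℤ.* (+ a ℤ.- + b)
    a₀-b₀≡ = difference-scale x Λ a b a₀ b₀ a₀≡ b₀≡
    a₀-b₀≡Σ : + a₀ ℤ.- + b₀ ≡ sumFin ℓ (λ i → + Λ ℤ.* ys i)
    a₀-b₀≡Σ = trans a₀-b₀≡ (trans (cong (+ Λ ℤ.*_) a-b≡Σys) (sym (sumFin-scale ℓ (+ Λ) ys)))
    Λys∈I : ∀ i → I (hd (h i) (D i) (d i)) (+ Λ ℤ.* ys i)
    Λys∈I i = subst (λ v → I (hd (h i) (D i) (d i)) (+ v ℤ.* ys i))
                (compOmit-complete ℓ F λ-pos (λ i j → lam-comm (D i) (D j)) i q q-pos)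
                (I-transfer (h i) (D i) (d i) (compOmit ℓ F i q) (d-pos i) (compOmit-pos ℓ F λ-pos i q q-pos) (ys i) (ys∈I i))
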